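{- For all integers $i,j,k,L$, $$ \sum_{s\ge 0} q^{s(L+2)-T_s+T_{i-s}+T_{j-s}+T_{k-s}} \begin{bmatrix} L-s\\ s,\ i-s,\ j-s\end{bmatrix} \begin{bmatrix} L-i-j\\ k-s\end{bmatrix} = q^{T_i+T_j+T_k}\begin{bmatrix} L-k\\ i\end{bmatrix}\begin{bmatrix} L-i\\ j\end{bmatrix}\begin{bmatrix} L-j\\ k\end{bmatrix}. $$
   Context: $T_n=n(n+1)/2$. For an integer $n$, $(x)_n=\prod_{j=0}^{n-1}(1-xq^j)$ if $n>0$, $(x)_0=1$, and $(x)_n=\prod_{j=1}^{ -n}(1-xq^{ -j})^{ -1}$ if $n<0$. For all integers $n,m$, $\begin{bmatrix} n+m\\ n\end{bmatrix}=\frac{(q^{m+1})_n}{(q)_n}$ if $n\ge0$ and $0$ if $n<0$. The $q$-multinomial coefficient is $\begin{bmatrix} L\\ a_1,\dots,a_r\end{bmatrix}=\frac{(q^{1+L-a_1-\cdots-a_r})_{a_1+\cdots+a_r}}{(q)_{a_1}\cdots(q)_{a_r}}$ if all $a_i\ge0$ and $0$ otherwise. -}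

module Defs where

open import Data.Nat as ℕ using (ℕ; zero; suc)
open import Data.Integer as ℤ using (ℤ; +_; -[1+_]; ∣_∣)
open import Data.Rational as ℚ using (ℚ; 0ℚ; 1ℚ)
open import Data.Rational.Properties using (_≟_)
open import Data.List using (List; []; _∷_)
open import Relation.Nullary using (yes; no)
open import Data.Bool using (Bool; true; false; if_then_else_)

-- total inverse on ℚ (0 ↦ 0); only ever applied to nonzero values
-- under the hypotheses of the theorem
inv : ℚ → ℚ
inv p with p ≟ 0ℚ
... | yes _ = 0ℚ
... | no p≢0 = ℚ.1/_ p {{ℚ.≢-nonZero p≢0}}

_^ⁿ_ : ℚ → ℕ → ℚ
x ^ⁿ zero = 1ℚ
x ^ⁿ suc n = x ℚ.* (x ^ⁿ n)

_^ᶻ_ : ℚ → ℤ → ℚ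
x ^ᶻ (+ n) = x ^ⁿ n
x ^ᶻ -[1+ n ] = inv (x ^ⁿ suc n)

T : ℤ → ℤ
T z = (z ℤ.* (z ℤ.+ + 1)) ℤ./ + 2

pochℕ : ℚ → ℚ → ℕ → ℚ
pochℕ q x zero = 1ℚ
pochℕ q x (suc n) = pochℕ q x n ℚ.* (1ℚ ℚ.- x ℚ.* (q ^ⁿ n))

pochNeg : ℚ → ℚ → ℕ → ℚ
pochNeg q x zero = 1ℚ
pochNeg q x (suc n) = pochNeg q x n ℚ.* inv (1ℚ ℚ.- x ℚ.* (q ^ᶻ -[1+ n ]))

poch : ℚ → ℚ → ℤ → ℚ
poch q x (+ n) = pochℕ q x n
poch q x -[1+ n ] = pochNeg q x (suc n)

qbinom : ℚ → ℤ → ℤ → ℚ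
qbinom q t (+ n) = poch q (q ^ᶻ ((t ℤ.- + n) ℤ.+ + 1)) (+ n) ℚ.* inv (poch q q (+ n))
qbinom q t -[1+ n ] = 0ℚ

sumℤ : List ℤ → ℤ
sumℤ [] = + 0
sumℤ (a ∷ as) = a ℤ.+ sumℤ as

-- product of (q)_{a_i} over a list of nonnegative integers;
-- qmultinomial returns 0 as soon as some a_i < 0
denom : ℚ → List ℤ → ℚ
denom q [] = 1ℚ
denom q (a ∷ as) = poch q q a ℚ.* denom q as

allNonNeg : List ℤ → Bool
allNonNeg [] = true
allNonNeg (+ _ ∷ as) = allNonNeg as
allNonNeg (-[1+ _ ] ∷ as) = false

qmultinom : ℚ → ℤ → List ℤ → ℚ
qmultinom q L as =
  if allNonNeg as
  then poch q (q ^ᶻ ((+ 1 ℤ.+ L) ℤ.- sumℤ as)) (sumℤ as) ℚ.* inv (denom q as)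
  else 0ℚ

Σ≤ : ℕ → (ℕ → ℚ) → ℚ
Σ≤ zero f = f zero
Σ≤ (suc N) f = Σ≤ N f ℚ.+ f (suc N)

{-# OPTIONS --safe #-}
-- Creative telescoping.  For natural i, j, k both sides X(i, j, k, L) satisfy
--   (1 - q^(i+1)) (1 - q^(j+1)) X(i+1, j+1, k, L+1)
--     = q^(i+j+2) (1 - q^(L-k+1)) (1 - q^(L-i-j)) X(i, j, k, L).
-- For the product of q-binomials this is the absorption identity
-- (1 - q^(m+1)) [t+1; m+1] = (1 - q^(t+1)) [t; m] and its companion; for the sum
-- it follows by summing an explicit Wilf–Zeilberger certificate G over s, which
-- reduces to a polynomial identity in a handful of q-powers and Pochhammer
-- symbols.  Since q is neither 0 nor a root of unity the left coefficient is
-- nonzero, so induction on i reduces everything to i = 0 or j = 0, where only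
-- the term s = 0 survives and both sides factor as [L; n] [L - n; m].  For
-- negative i, j or k every summand and the product vanish.
module Submission where

open import Data.List using ([]; _∷_; foldl)
open import Data.Nat as ℕ using (ℕ; zero; suc)
import Data.Nat.DivMod as ℕ
import Data.Nat.Properties as ℕ
open import Data.Nat.Tactic.RingSolver using () renaming (solve-∀ to ℕ-solve-∀)
open import Data.Integer as ℤ using (ℤ; +_; -[1+_]; ∣_∣)
import Data.Integer.Properties as ℤ
open import Data.Integer.Tactic.RingSolver using () renaming (solve-∀ to ℤ-solve-∀)
open import Data.Rational as ℚ using (ℚ; 0ℚ; 1ℚ; _+_; _*_; _-_; -_)
import Data.Rational.Properties as ℚ
open import Data.Product using (Σ; _,_; proj₂)
open import Data.Sum using (_⊎_; inj₁; inj₂)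
open import Function using (_∘_)
open import Level using (0ℓ)
open import Relation.Binary.PropositionalEquality
open import Relation.Nullary using (Dec; yes; no; ¬_; contradiction)
open import Relation.Nullary.Decidable using (dec⇒maybe)
open import Tactic.RingSolver using (solve-∀)
import Tactic.RingSolver.Core.AlmostCommutativeRing as ACR

open import Defs
open import Algebra.Properties.Group ℚ.+-0-group using () renaming (x∙y⁻¹≈ε⇒x≈y to x-y≡0⇒x≡y)

open ≡-Reasoning

ℚ-ring : ACR.AlmostCommutativeRing 0ℓ 0ℓ
ℚ-ring = ACR.fromCommutativeRing ℚ.+-*-commutativeRing (λ p → dec⇒maybe (0ℚ ℚ.≟ p))

-- Inverses and integer powers

inv-inverseʳ : ∀ {x} → x ≢ 0ℚ → x * inv x ≡ 1ℚ
inv-inverseʳ {x} x≢0 with x ℚ.≟ 0ℚ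
... | yes x≡0 = contradiction x≡0 x≢0
... | no  x≢0 = ℚ.*-inverseʳ x {{ℚ.≢-nonZero x≢0}}

*-cancelˡ-≢0 : ∀ {c x y} → c ≢ 0ℚ → c * x ≡ c * y → x ≡ y
*-cancelˡ-≢0 {c} {x} {y} c≢0 cx≡cy = begin
  x                ≡⟨ sym (ℚ.*-identityˡ x) ⟩
  1ℚ * x           ≡⟨ cong (_* x) (sym (inv-inverseʳ c≢0)) ⟩
  c * inv c * x    ≡⟨ regroup c (inv c) x ⟩
  inv c * (c * x)  ≡⟨ cong (inv c *_) cx≡cy ⟩
  inv c * (c * y)  ≡⟨ sym (regroup c (inv c) y) ⟩
  c * inv c * y    ≡⟨ cong (_* y) (inv-inverseʳ c≢0) ⟩
  1ℚ * y           ≡⟨ ℚ.*-identityˡ y ⟩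
  y                ∎
  where
  regroup : ∀ a b z → a * b * z ≡ b * (a * z)
  regroup = solve-∀ ℚ-ring

*-≢0 : ∀ {x y} → x ≢ 0ℚ → y ≢ 0ℚ → x * y ≢ 0ℚ
*-≢0 {x} x≢0 y≢0 xy≡0 = y≢0 (*-cancelˡ-≢0 x≢0 (trans xy≡0 (sym (ℚ.*-zeroʳ x))))

inv-distrib-* : ∀ x y → inv (x * y) ≡ inv x * inv y
inv-distrib-* x y = by-cases (x ℚ.≟ 0ℚ) (y ℚ.≟ 0ℚ)
  where
  by-cases : Dec (x ≡ 0ℚ) → Dec (y ≡ 0ℚ) → inv (x * y) ≡ inv x * inv y
  by-cases (yes x≡0) _ = begin
    inv (x * y)    ≡⟨ cong inv (trans (cong (_* y) x≡0) (ℚ.*-zeroˡ y)) ⟩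
    0ℚ             ≡⟨ sym (ℚ.*-zeroˡ (inv y)) ⟩
    0ℚ * inv y     ≡⟨ cong (λ u → inv u * inv y) (sym x≡0) ⟩
    inv x * inv y  ∎
  by-cases _ (yes y≡0) = begin
    inv (x * y)    ≡⟨ cong inv (trans (cong (x *_) y≡0) (ℚ.*-zeroʳ x)) ⟩
    0ℚ             ≡⟨ sym (ℚ.*-zeroʳ (inv x)) ⟩
    inv x * 0ℚ     ≡⟨ cong (λ u → inv x * inv u) (sym y≡0) ⟩
    inv x * inv y  ∎
  by-cases (no x≢0) (no y≢0) = *-cancelˡ-≢0 (*-≢0 x≢0 y≢0) (begin
    x * y * inv (x * y)        ≡⟨ inv-inverseʳ (*-≢0 x≢0 y≢0) ⟩
    1ℚ                         ≡⟨ sym (cong₂ _*_ (inv-inverseʳ x≢0) (inv-inverseʳ y≢0)) ⟩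
    x * inv x * (y * inv y)    ≡⟨ regroup x (inv x) y (inv y) ⟩
    x * y * (inv x * inv y)    ∎)
    where
    regroup : ∀ a a′ b b′ → a * a′ * (b * b′) ≡ a * b * (a′ * b′)
    regroup = solve-∀ ℚ-ring

1-x≡0⇒x≡1 : ∀ {x} → 1ℚ - x ≡ 0ℚ → x ≡ 1ℚ
1-x≡0⇒x≡1 {x} 1-x≡0 = begin
  x              ≡⟨ rearrange x ⟩
  1ℚ - (1ℚ - x)  ≡⟨ cong (λ y → 1ℚ - y) 1-x≡0 ⟩
  1ℚ - 0ℚ        ≡⟨⟩
  1ℚ             ∎
  where
  rearrange : ∀ x → x ≡ 1ℚ - (1ℚ - x)
  rearrange = solve-∀ ℚ-ring

^ⁿ-+ : ∀ x m n → x ^ⁿ (m ℕ.+ n) ≡ x ^ⁿ m * x ^ⁿ n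
^ⁿ-+ x zero    n = sym (ℚ.*-identityˡ _)
^ⁿ-+ x (suc m) n = trans (cong (x *_) (^ⁿ-+ x m n)) (sym (ℚ.*-assoc x _ _))

^ⁿ-≢0 : ∀ {x} n → x ≢ 0ℚ → x ^ⁿ n ≢ 0ℚ
^ⁿ-≢0 zero    _   ()
^ⁿ-≢0 (suc n) x≢0 = *-≢0 x≢0 (^ⁿ-≢0 n x≢0)

module _ {x : ℚ} (x≢0 : x ≢ 0ℚ) where

  ^ᶻ-suc : ∀ z → x ^ᶻ (+ 1 ℤ.+ z) ≡ x * x ^ᶻ z
  ^ᶻ-suc (+ n)            = refl
  ^ᶻ-suc -[1+ zero ]      = sym (trans (cong (λ y → x * inv y) (ℚ.*-identityʳ x)) (inv-inverseʳ x≢0))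
  ^ᶻ-suc -[1+ suc n ]     = sym (begin
    x * inv (x * (x * x ^ⁿ n))          ≡⟨ cong (x *_) (inv-distrib-* x _) ⟩
    x * (inv x * inv (x * x ^ⁿ n))      ≡⟨ sym (ℚ.*-assoc x (inv x) _) ⟩
    x * inv x * inv (x * x ^ⁿ n)        ≡⟨ cong (_* inv (x * x ^ⁿ n)) (inv-inverseʳ x≢0) ⟩
    1ℚ * inv (x * x ^ⁿ n)               ≡⟨ ℚ.*-identityˡ _ ⟩
    inv (x * x ^ⁿ n)                    ∎)

  ^ᶻ-+ℕ : ∀ n z → x ^ᶻ (+ n ℤ.+ z) ≡ x ^ⁿ n * x ^ᶻ z
  ^ᶻ-+ℕ zero    z = trans (cong (x ^ᶻ_) (ℤ.+-identityˡ z)) (sym (ℚ.*-identityˡ _))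
  ^ᶻ-+ℕ (suc n) z = begin
    x ^ᶻ (+ suc n ℤ.+ z)          ≡⟨ cong (x ^ᶻ_) (ℤ.+-assoc (+ 1) (+ n) z) ⟩
    x ^ᶻ (+ 1 ℤ.+ (+ n ℤ.+ z))    ≡⟨ ^ᶻ-suc (+ n ℤ.+ z) ⟩
    x * x ^ᶻ (+ n ℤ.+ z)          ≡⟨ cong (x *_) (^ᶻ-+ℕ n z) ⟩
    x * (x ^ⁿ n * x ^ᶻ z)         ≡⟨ sym (ℚ.*-assoc x _ _) ⟩
    x * x ^ⁿ n * x ^ᶻ z           ∎

  ^ᶻ-+ : ∀ z w → x ^ᶻ (z ℤ.+ w) ≡ x ^ᶻ z * x ^ᶻ w
  ^ᶻ-+ (+ n)     w = ^ᶻ-+ℕ n w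
  ^ᶻ-+ -[1+ n ] w = *-cancelˡ-≢0 xⁿ⁺¹≢0 (begin
    xⁿ⁺¹ * x ^ᶻ (-[1+ n ] ℤ.+ w)          ≡⟨ sym (^ᶻ-+ℕ (suc n) (-[1+ n ] ℤ.+ w)) ⟩
    x ^ᶻ (+ suc n ℤ.+ (-[1+ n ] ℤ.+ w))   ≡⟨ cong (x ^ᶻ_) (cancel (+ suc n) w) ⟩
    x ^ᶻ w                                 ≡⟨ sym (ℚ.*-identityˡ _) ⟩
    1ℚ * x ^ᶻ w                            ≡⟨ cong (_* x ^ᶻ w) (sym (inv-inverseʳ xⁿ⁺¹≢0)) ⟩
    xⁿ⁺¹ * inv xⁿ⁺¹ * x ^ᶻ w              ≡⟨ ℚ.*-assoc xⁿ⁺¹ _ _ ⟩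
    xⁿ⁺¹ * (inv xⁿ⁺¹ * x ^ᶻ w)            ∎)
    where
    xⁿ⁺¹ = x ^ⁿ suc n
    xⁿ⁺¹≢0 = ^ⁿ-≢0 (suc n) x≢0
    cancel : ∀ m w → m ℤ.+ (ℤ.- m ℤ.+ w) ≡ w
    cancel = ℤ-solve-∀

-- Triangular numbers and the exponent of q in the summand

tri : ℕ → ℕ
tri zero    = 0
tri (suc n) = tri n ℕ.+ suc n

tri*2 : ∀ n → tri n ℕ.* 2 ≡ n ℕ.* suc n
tri*2 zero    = refl
tri*2 (suc n) = begin
  (tri n ℕ.+ suc n) ℕ.* 2        ≡⟨ ℕ.*-distribʳ-+ 2 (tri n) (suc n) ⟩
  tri n ℕ.* 2 ℕ.+ suc n ℕ.* 2    ≡⟨ cong (ℕ._+ suc n ℕ.* 2) (tri*2 n) ⟩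
  n ℕ.* suc n ℕ.+ suc n ℕ.* 2    ≡⟨ expand n ⟩
  suc n ℕ.* suc (suc n)          ∎
  where
  expand : ∀ n → n ℕ.* suc n ℕ.+ suc n ℕ.* 2 ≡ suc n ℕ.* suc (suc n)
  expand = ℕ-solve-∀

z[z+1]≡tri*2 : ∀ z → Σ ℕ λ n → z ℤ.* (z ℤ.+ + 1) ≡ + (tri n ℕ.* 2)
z[z+1]≡tri*2 (+ n)     = n , (begin
  + n ℤ.* + (n ℕ.+ 1)   ≡⟨ sym (ℤ.pos-* n (n ℕ.+ 1)) ⟩
  + (n ℕ.* (n ℕ.+ 1))   ≡⟨ cong (λ m → + (n ℕ.* m)) (ℕ.+-comm n 1) ⟩
  + (n ℕ.* suc n)       ≡⟨ cong +_ (sym (tri*2 n)) ⟩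
  + (tri n ℕ.* 2)       ∎)
z[z+1]≡tri*2 -[1+ n ] = n , trans (reflect (+ n)) (proj₂ (z[z+1]≡tri*2 (+ n)))
  where
  reflect : ∀ a → ℤ.- (+ 1 ℤ.+ a) ℤ.* (ℤ.- (+ 1 ℤ.+ a) ℤ.+ + 1) ≡ a ℤ.* (a ℤ.+ + 1)
  reflect = ℤ-solve-∀

T*2 : ∀ z → T z ℤ.* + 2 ≡ z ℤ.* (z ℤ.+ + 1)
T*2 z with z[z+1]≡tri*2 z
... | n , z[z+1]≡ = begin
  T z ℤ.* + 2                       ≡⟨ cong (λ a → a ℤ./ + 2 ℤ.* + 2) z[z+1]≡ ⟩
  + (tri n ℕ.* 2) ℤ./ + 2 ℤ.* + 2   ≡⟨ cong (ℤ._* + 2) half ⟩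
  + tri n ℤ.* + 2                   ≡⟨ sym (ℤ.pos-* (tri n) 2) ⟩
  + (tri n ℕ.* 2)                   ≡⟨ sym z[z+1]≡ ⟩
  z ℤ.* (z ℤ.+ + 1)                 ∎
  where
  half : + (tri n ℕ.* 2) ℤ./ + 2 ≡ + tri n
  half = trans (ℤ.*-identityˡ _) (cong +_ (ℕ.m*n/n≡m (tri n) 2))

T-suc : ∀ z → T (+ 1 ℤ.+ z) ≡ T z ℤ.+ (+ 1 ℤ.+ z)
T-suc z = ℤ.*-cancelʳ-≡ _ _ (+ 2) (begin
  T (+ 1 ℤ.+ z) ℤ.* + 2                          ≡⟨ T*2 (+ 1 ℤ.+ z) ⟩
  (+ 1 ℤ.+ z) ℤ.* ((+ 1 ℤ.+ z) ℤ.+ + 1)          ≡⟨ expand z ⟩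
  z ℤ.* (z ℤ.+ + 1) ℤ.+ (+ 1 ℤ.+ z) ℤ.* + 2      ≡⟨ cong (ℤ._+ (+ 1 ℤ.+ z) ℤ.* + 2) (sym (T*2 z)) ⟩
  T z ℤ.* + 2 ℤ.+ (+ 1 ℤ.+ z) ℤ.* + 2            ≡⟨ sym (ℤ.*-distribʳ-+ (+ 2) (T z) (+ 1 ℤ.+ z)) ⟩
  (T z ℤ.+ (+ 1 ℤ.+ z)) ℤ.* + 2                  ∎)
  where
  expand : ∀ z → (+ 1 ℤ.+ z) ℤ.* ((+ 1 ℤ.+ z) ℤ.+ + 1) ≡ z ℤ.* (z ℤ.+ + 1) ℤ.+ (+ 1 ℤ.+ z) ℤ.* + 2
  expand = ℤ-solve-∀

T-step : ∀ z {w} → w ≡ + 1 ℤ.+ z → T w ≡ T z ℤ.+ w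
T-step z refl = T-suc z

E : ℤ → ℤ → ℤ → ℤ → ℤ → ℤ
E i j k L s = s ℤ.* (L ℤ.+ + 2) ℤ.- T s ℤ.+ T (i ℤ.- s) ℤ.+ T (j ℤ.- s) ℤ.+ T (k ℤ.- s)

N : ℤ → ℤ → ℤ → ℤ → ℤ
N i j k L = L ℤ.- i ℤ.- j ℤ.- k

E-shift : ∀ i j k L s →
  E (+ 1 ℤ.+ i) (+ 1 ℤ.+ j) k (+ 1 ℤ.+ L) s ≡ E i j k L s ℤ.+ + 1 ℤ.+ + 1 ℤ.+ (i ℤ.- s) ℤ.+ (j ℤ.- s) ℤ.+ s
E-shift i j k L s = begin
  s ℤ.* ((+ 1 ℤ.+ L) ℤ.+ + 2) ℤ.- T s ℤ.+ T ((+ 1 ℤ.+ i) ℤ.- s) ℤ.+ T ((+ 1 ℤ.+ j) ℤ.- s) ℤ.+ T (k ℤ.- s)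
    ≡⟨ cong₂ (λ u v → s ℤ.* ((+ 1 ℤ.+ L) ℤ.+ + 2) ℤ.- T s ℤ.+ u ℤ.+ v ℤ.+ T (k ℤ.- s))
             (T-step (i ℤ.- s) (shift i s)) (T-step (j ℤ.- s) (shift j s)) ⟩
  s ℤ.* ((+ 1 ℤ.+ L) ℤ.+ + 2) ℤ.- T s ℤ.+ (T (i ℤ.- s) ℤ.+ ((+ 1 ℤ.+ i) ℤ.- s))
    ℤ.+ (T (j ℤ.- s) ℤ.+ ((+ 1 ℤ.+ j) ℤ.- s)) ℤ.+ T (k ℤ.- s)
    ≡⟨ regroup s L i j (T s) (T (i ℤ.- s)) (T (j ℤ.- s)) (T (k ℤ.- s)) ⟩
  E i j k L s ℤ.+ + 1 ℤ.+ + 1 ℤ.+ (i ℤ.- s) ℤ.+ (j ℤ.- s) ℤ.+ s ∎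
  where
  shift : ∀ i s → (+ 1 ℤ.+ i) ℤ.- s ≡ + 1 ℤ.+ (i ℤ.- s)
  shift = ℤ-solve-∀
  regroup : ∀ s L i j tₛ tᵢ tⱼ tₖ →
    s ℤ.* ((+ 1 ℤ.+ L) ℤ.+ + 2) ℤ.- tₛ ℤ.+ (tᵢ ℤ.+ ((+ 1 ℤ.+ i) ℤ.- s))
      ℤ.+ (tⱼ ℤ.+ ((+ 1 ℤ.+ j) ℤ.- s)) ℤ.+ tₖ
    ≡ s ℤ.* (L ℤ.+ + 2) ℤ.- tₛ ℤ.+ tᵢ ℤ.+ tⱼ ℤ.+ tₖ ℤ.+ + 1 ℤ.+ + 1 ℤ.+ (i ℤ.- s) ℤ.+ (j ℤ.- s) ℤ.+ s
  regroup = ℤ-solve-∀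

E-suc : ∀ i j k L s → E i j k L (+ 1 ℤ.+ s) ≡ E i j k L s ℤ.+ + 1 ℤ.+ (N i j k L ℤ.+ s) ℤ.+ s
E-suc i j k L s = begin
  (+ 1 ℤ.+ s) ℤ.* (L ℤ.+ + 2) ℤ.- T (+ 1 ℤ.+ s) ℤ.+ tᵢ ℤ.+ tⱼ ℤ.+ tₖ
    ≡⟨ cong (λ u → (+ 1 ℤ.+ s) ℤ.* (L ℤ.+ + 2) ℤ.- u ℤ.+ tᵢ ℤ.+ tⱼ ℤ.+ tₖ) (T-suc s) ⟩
  (+ 1 ℤ.+ s) ℤ.* (L ℤ.+ + 2) ℤ.- (T s ℤ.+ (+ 1 ℤ.+ s)) ℤ.+ tᵢ ℤ.+ tⱼ ℤ.+ tₖ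
    ≡⟨ regroup s L i j k (T s) tᵢ tⱼ tₖ ⟩
  s ℤ.* (L ℤ.+ + 2) ℤ.- T s ℤ.+ (tᵢ ℤ.+ (i ℤ.- s)) ℤ.+ (tⱼ ℤ.+ (j ℤ.- s)) ℤ.+ (tₖ ℤ.+ (k ℤ.- s))
    ℤ.+ + 1 ℤ.+ (N i j k L ℤ.+ s) ℤ.+ s
    ≡⟨ cong₂ (λ u v → s ℤ.* (L ℤ.+ + 2) ℤ.- T s ℤ.+ u ℤ.+ v ℤ.+ (tₖ ℤ.+ (k ℤ.- s))
                        ℤ.+ + 1 ℤ.+ (N i j k L ℤ.+ s) ℤ.+ s)
             (sym (T-step (i ℤ.- (+ 1 ℤ.+ s)) (unshift i s))) (sym (T-step (j ℤ.- (+ 1 ℤ.+ s)) (unshift j s))) ⟩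
  s ℤ.* (L ℤ.+ + 2) ℤ.- T s ℤ.+ T (i ℤ.- s) ℤ.+ T (j ℤ.- s) ℤ.+ (tₖ ℤ.+ (k ℤ.- s))
    ℤ.+ + 1 ℤ.+ (N i j k L ℤ.+ s) ℤ.+ s
    ≡⟨ cong (λ u → s ℤ.* (L ℤ.+ + 2) ℤ.- T s ℤ.+ T (i ℤ.- s) ℤ.+ T (j ℤ.- s) ℤ.+ u
                     ℤ.+ + 1 ℤ.+ (N i j k L ℤ.+ s) ℤ.+ s)
            (sym (T-step (k ℤ.- (+ 1 ℤ.+ s)) (unshift k s))) ⟩
  E i j k L s ℤ.+ + 1 ℤ.+ (N i j k L ℤ.+ s) ℤ.+ s ∎
  where
  tᵢ = T (i ℤ.- (+ 1 ℤ.+ s))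
  tⱼ = T (j ℤ.- (+ 1 ℤ.+ s))
  tₖ = T (k ℤ.- (+ 1 ℤ.+ s))
  unshift : ∀ i s → i ℤ.- s ≡ + 1 ℤ.+ (i ℤ.- (+ 1 ℤ.+ s))
  unshift = ℤ-solve-∀
  regroup : ∀ s L i j k tₛ tᵢ tⱼ tₖ →
    (+ 1 ℤ.+ s) ℤ.* (L ℤ.+ + 2) ℤ.- (tₛ ℤ.+ (+ 1 ℤ.+ s)) ℤ.+ tᵢ ℤ.+ tⱼ ℤ.+ tₖ
    ≡ s ℤ.* (L ℤ.+ + 2) ℤ.- tₛ ℤ.+ (tᵢ ℤ.+ (i ℤ.- s)) ℤ.+ (tⱼ ℤ.+ (j ℤ.- s)) ℤ.+ (tₖ ℤ.+ (k ℤ.- s))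
      ℤ.+ + 1 ℤ.+ (L ℤ.- i ℤ.- j ℤ.- k ℤ.+ s) ℤ.+ s
  regroup = ℤ-solve-∀

-- Vanishing of binomial coefficients

⊖-negative : ∀ {m n} → m ℕ.< n → ℤ.Negative (m ℤ.⊖ n)
⊖-negative {zero}  {suc n} _            = _
⊖-negative {suc m} {suc n} (ℕ.s≤s m<n) = subst ℤ.Negative (sym (ℤ.[1+m]⊖[1+n]≡m⊖n m n)) (⊖-negative m<n)

[+m]-[+n]-negative : ∀ {m n} → m ℕ.< n → ℤ.Negative (+ m ℤ.- + n)
[+m]-[+n]-negative {m} {n} m<n = subst ℤ.Negative (sym (ℤ.[+m]-[+n]≡m⊖n m n)) (⊖-negative m<n)

-[1+n]-[+s]-negative : ∀ n s → ℤ.Negative (-[1+ n ] ℤ.- + s)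
-[1+n]-[+s]-negative n zero    = _
-[1+n]-[+s]-negative n (suc s) = _

qmultinom-vanishes : ∀ q M s x y → ℤ.Negative x ⊎ ℤ.Negative y → qmultinom q M (+ s ∷ x ∷ y ∷ []) ≡ 0ℚ
qmultinom-vanishes q M s -[1+ _ ] y        _         = refl
qmultinom-vanishes q M s (+ _)    -[1+ _ ] _         = refl
qmultinom-vanishes q M s (+ _)    (+ _)    (inj₁ ())
qmultinom-vanishes q M s (+ _)    (+ _)    (inj₂ ())

qbinom-vanishes : ∀ q t z → ℤ.Negative z → qbinom q t z ≡ 0ℚ
qbinom-vanishes q t -[1+ _ ] _ = refl

OutOfRange : ℤ → ℤ → ℤ → ℕ → Set
OutOfRange i j k s = ℤ.Negative (i ℤ.- + s) ⊎ ℤ.Negative (j ℤ.- + s) ⊎ ℤ.Negative (k ℤ.- + s)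

-- Pochhammer symbols and finite sums

pochℕ-+ : ∀ q x m n → pochℕ q x (m ℕ.+ n) ≡ pochℕ q x m * pochℕ q (x * q ^ⁿ m) n
pochℕ-+ q x m zero    = trans (cong (pochℕ q x) (ℕ.+-identityʳ m)) (sym (ℚ.*-identityʳ _))
pochℕ-+ q x m (suc n) = begin
  pochℕ q x (m ℕ.+ suc n)
    ≡⟨ cong (pochℕ q x) (ℕ.+-suc m n) ⟩
  pochℕ q x (m ℕ.+ n) * (1ℚ - x * q ^ⁿ (m ℕ.+ n))
    ≡⟨ cong₂ (λ u v → u * (1ℚ - x * v)) (pochℕ-+ q x m n) (^ⁿ-+ q m n) ⟩
  pochℕ q x m * pochℕ q (x * q ^ⁿ m) n * (1ℚ - x * (q ^ⁿ m * q ^ⁿ n))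
    ≡⟨ regroup (pochℕ q x m) (pochℕ q (x * q ^ⁿ m) n) x (q ^ⁿ m) (q ^ⁿ n) ⟩
  pochℕ q x m * (pochℕ q (x * q ^ⁿ m) n * (1ℚ - x * q ^ⁿ m * q ^ⁿ n)) ∎
  where
  regroup : ∀ a b x u v → a * b * (1ℚ - x * (u * v)) ≡ a * (b * (1ℚ - x * u * v))
  regroup = solve-∀ ℚ-ring

pochℕ-cons : ∀ q x n → pochℕ q x (suc n) ≡ (1ℚ - x) * pochℕ q (x * q) n
pochℕ-cons q x n = trans (pochℕ-+ q x 1 n) (cong₂ _*_ (first-factor x) (cong (λ y → pochℕ q (x * y) n) (ℚ.*-identityʳ q)))
  where
  first-factor : ∀ x → 1ℚ * (1ℚ - x * 1ℚ) ≡ 1ℚ - x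
  first-factor = solve-∀ ℚ-ring

Σ≤-cong : ∀ n {f g : ℕ → ℚ} → (∀ s → f s ≡ g s) → Σ≤ n f ≡ Σ≤ n g
Σ≤-cong zero    f≡g = f≡g 0
Σ≤-cong (suc n) f≡g = cong₂ _+_ (Σ≤-cong n f≡g) (f≡g (suc n))

Σ≤-linear : ∀ n (f g : ℕ → ℚ) x y → Σ≤ n (λ s → x * f s - y * g s) ≡ x * Σ≤ n f - y * Σ≤ n g
Σ≤-linear zero    f g x y = refl
Σ≤-linear (suc n) f g x y = trans (cong (_+ (x * f (suc n) - y * g (suc n))) (Σ≤-linear n f g x y))
                                  (regroup x y (Σ≤ n f) (Σ≤ n g) (f (suc n)) (g (suc n)))
  where
  regroup : ∀ x y a b c d → x * a - y * b + (x * c - y * d) ≡ x * (a + c) - y * (b + d)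
  regroup = solve-∀ ℚ-ring

Σ≤-telescope : ∀ n (G : ℕ → ℚ) → Σ≤ n (λ s → G (suc s) - G s) ≡ G (suc n) - G 0
Σ≤-telescope zero    G = refl
Σ≤-telescope (suc n) G = trans (cong (_+ (G (suc (suc n)) - G (suc n))) (Σ≤-telescope n G))
                               (collapse (G (suc (suc n))) (G (suc n)) (G 0))
  where
  collapse : ∀ a b c → b - c + (a - b) ≡ a - c
  collapse = solve-∀ ℚ-ring

Σ≤-head : ∀ n (f : ℕ → ℚ) → (∀ s → f (suc s) ≡ 0ℚ) → Σ≤ n f ≡ f 0
Σ≤-head zero    f tail≡0 = refl
Σ≤-head (suc n) f tail≡0 = trans (cong₂ _+_ (Σ≤-head n f tail≡0) (tail≡0 n)) (ℚ.+-identityʳ (f 0))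

Σ≤-zero : ∀ n (f : ℕ → ℚ) → (∀ s → f s ≡ 0ℚ) → Σ≤ n f ≡ 0ℚ
Σ≤-zero n f f≡0 = trans (Σ≤-head n f (f≡0 ∘ suc)) (f≡0 0)

product₄-zero : ∀ {a b c d} → a ≡ 0ℚ ⊎ b ≡ 0ℚ ⊎ c ≡ 0ℚ ⊎ d ≡ 0ℚ → a * b * c * d ≡ 0ℚ
product₄-zero {_} {b} {c} {d} (inj₁ refl)               = first b c d
  where
  first : ∀ b c d → 0ℚ * b * c * d ≡ 0ℚ
  first = solve-∀ ℚ-ring
product₄-zero {a} {_} {c} {d} (inj₂ (inj₁ refl))        = second a c d
  where
  second : ∀ a c d → a * 0ℚ * c * d ≡ 0ℚ
  second = solve-∀ ℚ-ring
product₄-zero {a} {b} {_} {d} (inj₂ (inj₂ (inj₁ refl))) = third a b d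
  where
  third : ∀ a b d → a * b * 0ℚ * d ≡ 0ℚ
  third = solve-∀ ℚ-ring
product₄-zero {a} {b} {c} {_} (inj₂ (inj₂ (inj₂ refl))) = ℚ.*-zeroʳ (a * b * c)

certificate-identity : ∀ q A B C X P e long short r₀ rᵢ rⱼ rₖ →
  (1ℚ - q * A * X) * (1ℚ - q * B * X) * (e * q * q * A * B * X * long * (r₀ * rᵢ * rⱼ * rₖ))
  - q * q * A * B * X * X * (1ℚ - q * P * A * B * X) * (1ℚ - P * C)
    * (e * short * (r₀ * ((1ℚ - q * A) * rᵢ) * ((1ℚ - q * B) * rⱼ) * rₖ))
  ≡ - (q * A * B * X * (1ℚ - q * A * B * X)) * (e * q * P * X) * short
      * (r₀ * ((1ℚ - q * A) * rᵢ) * ((1ℚ - q * B) * rⱼ) * ((1ℚ - C) * rₖ))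
    - - (q * q * A * B * X * (1ℚ - q * q * A * B * X)) * e * long * ((1ℚ - X) * r₀ * rᵢ * rⱼ * rₖ)
    + q * q * A * B * X * X * e
      * (r₀ * ((1ℚ - q * A) * rᵢ) * ((1ℚ - q * B) * rⱼ) * rₖ
         * (long - (1ℚ - P) * (short * (1ℚ - q * P * A * B * C * X))))
certificate-identity = solve-∀ ℚ-ring

module _ (q : ℚ) where

  infix 8 q^_

  q^_ : ℤ → ℚ
  q^ z = q ^ᶻ z

  qpoch : ℤ → ℕ → ℚ
  qpoch a n = pochℕ q (q^ a) n

  qfac : ℕ → ℚ
  qfac n = pochℕ q q n

  1/qfac : ℤ → ℚ
  1/qfac (+ n)    = inv (qfac n)
  1/qfac -[1+ _ ] = 0ℚ

  summand : ℤ → ℤ → ℤ → ℤ → ℕ → ℚ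
  summand i j k L s =
    q^ E i j k L (+ s) * qmultinom q (L ℤ.- + s) (+ s ∷ (i ℤ.- + s) ∷ (j ℤ.- + s) ∷ [])
                       * qbinom q (L ℤ.- i ℤ.- j) (k ℤ.- + s)

  binomProduct : ℤ → ℤ → ℤ → ℤ → ℚ
  binomProduct i j k L =
    q^ (T i ℤ.+ T j ℤ.+ T k) * qbinom q (L ℤ.- k) i * qbinom q (L ℤ.- i) j * qbinom q (L ℤ.- j) k

  -- The length i + j + k ∸ 2s is truncated; this only matters when s exceeds
  -- i, j or k, and then one of the factors 1/qfac vanishes.
  F : ℕ → ℕ → ℕ → ℤ → ℕ → ℚ
  F i j k L s =
    q^ E (+ i) (+ j) (+ k) L (+ s)
    * qpoch (+ 1 ℤ.+ (N (+ i) (+ j) (+ k) L ℤ.+ + s)) ((i ℕ.+ j ℕ.+ k) ℕ.∸ (s ℕ.+ s))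
    * (1/qfac (+ s) * 1/qfac (+ i ℤ.- + s) * 1/qfac (+ j ℤ.- + s) * 1/qfac (+ k ℤ.- + s))

  sumF : ℕ → ℕ → ℕ → ℤ → ℚ
  sumF i j k L = Σ≤ i (F i j k L)

  -- The Wilf–Zeilberger certificate for the recurrence
  -- c₁ i j * sumF (suc i) (suc j) k (L + 1) ≡ c₂ i j k L * sumF i j k L.
  G : ℕ → ℕ → ℕ → ℤ → ℕ → ℚ
  G i j k L s =
    let Y = q^ (+ i ℤ.+ + j ℤ.+ + 2 ℤ.- + s) in
    - (Y * (1ℚ - Y)) * q^ E (+ i) (+ j) (+ k) L (+ s)
    * qpoch (N (+ i) (+ j) (+ k) L ℤ.+ + s) ((i ℕ.+ j ℕ.+ k ℕ.+ 2) ℕ.∸ (s ℕ.+ s))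
    * (1/qfac (+ s ℤ.- + 1) * 1/qfac (+ suc i ℤ.- + s) * 1/qfac (+ suc j ℤ.- + s) * 1/qfac (+ k ℤ.- + s))

  c₁ : ℕ → ℕ → ℚ
  c₁ i j = (1ℚ - q^ (+ suc i)) * (1ℚ - q^ (+ suc j))

  c₂ : ℕ → ℕ → ℕ → ℤ → ℚ
  c₂ i j k L = q^ (+ i ℤ.+ + j ℤ.+ + 2) * (1ℚ - q^ (+ 1 ℤ.+ (L ℤ.- + k))) * (1ℚ - q^ (L ℤ.- + i ℤ.- + j))

  module _ (q≢0 : q ≢ 0ℚ) (q^suc≢1 : ∀ n → q ^ⁿ suc n ≢ 1ℚ) where

    q^-+ : ∀ z w → q^ (z ℤ.+ w) ≡ q^ z * q^ w
    q^-+ = ^ᶻ-+ q≢0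

    q^-foldl : ∀ z ws → q^ foldl ℤ._+_ z ws ≡ foldl (λ p w → p * q^ w) (q^ z) ws
    q^-foldl z []       = refl
    q^-foldl z (w ∷ ws) = trans (q^-foldl (z ℤ.+ w) ws) (cong (λ p → foldl (λ p w → p * q^ w) p ws) (q^-+ z w))

    q^-split : ∀ {x} z ws → x ≡ foldl ℤ._+_ z ws → q^ x ≡ foldl (λ p w → p * q^ w) (q^ z) ws
    q^-split z ws refl = q^-foldl z ws

    1-q^suc≢0 : ∀ n → 1ℚ - q^ (+ suc n) ≢ 0ℚ
    1-q^suc≢0 n = q^suc≢1 n ∘ 1-x≡0⇒x≡1

    1/qfac-step : ∀ z → 1/qfac z ≡ (1ℚ - q^ (+ 1 ℤ.+ z)) * 1/qfac (+ 1 ℤ.+ z)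
    1/qfac-step (+ n)          = sym (begin
      u * inv (qfac n * u)        ≡⟨ cong (u *_) (inv-distrib-* (qfac n) u) ⟩
      u * (inv (qfac n) * inv u)  ≡⟨ regroup u (inv (qfac n)) (inv u) ⟩
      u * inv u * inv (qfac n)    ≡⟨ cong (_* inv (qfac n)) (inv-inverseʳ (1-q^suc≢0 n)) ⟩
      1ℚ * inv (qfac n)           ≡⟨ ℚ.*-identityˡ _ ⟩
      inv (qfac n)                ∎)
      where
      u = 1ℚ - q^ (+ suc n)
      regroup : ∀ a b c → a * (b * c) ≡ a * c * b
      regroup = solve-∀ ℚ-ring
    1/qfac-step -[1+ zero ]    = refl
    1/qfac-step -[1+ suc n ]   = sym (ℚ.*-zeroʳ (1ℚ - q^ -[1+ n ]))

    1/qfac-step′ : ∀ z {w} → + 1 ℤ.+ z ≡ w → 1/qfac z ≡ (1ℚ - q^ w) * 1/qfac w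
    1/qfac-step′ z refl = 1/qfac-step z

    1/qfac-negative : ∀ z → ℤ.Negative z → 1/qfac z ≡ 0ℚ
    1/qfac-negative -[1+ _ ] _ = refl

    qpoch-+ : ∀ a m n → qpoch a (m ℕ.+ n) ≡ qpoch a m * qpoch (a ℤ.+ + m) n
    qpoch-+ a m n = trans (pochℕ-+ q (q^ a) m n) (cong (λ x → qpoch a m * pochℕ q x n) (sym (q^-+ a (+ m))))

    qpoch-snoc : ∀ a n → qpoch a (suc n) ≡ qpoch a n * (1ℚ - q^ (a ℤ.+ + n))
    qpoch-snoc a n = cong (λ x → qpoch a n * (1ℚ - x)) (sym (q^-+ a (+ n)))

    qpoch-cons : ∀ a n → qpoch a (suc n) ≡ (1ℚ - q^ a) * qpoch (+ 1 ℤ.+ a) n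
    qpoch-cons a n = trans (pochℕ-cons q (q^ a) n) (cong (λ x → (1ℚ - q^ a) * pochℕ q x n) (sym (begin
      q^ (+ 1 ℤ.+ a)     ≡⟨ q^-+ (+ 1) a ⟩
      q * 1ℚ * q^ a      ≡⟨ commute q (q^ a) ⟩
      q^ a * q           ∎)))
      where
      commute : ∀ x y → x * 1ℚ * y ≡ y * x
      commute = solve-∀ ℚ-ring

    qbinom-suc-suc : ∀ t m → (1ℚ - q^ (+ suc m)) * qbinom q (+ 1 ℤ.+ t) (+ suc m)
                           ≡ (1ℚ - q^ (+ 1 ℤ.+ t)) * qbinom q t (+ m)
    qbinom-suc-suc t m = begin
      u * (qpoch a′ (suc m) * 1/qfac (+ suc m))
        ≡⟨ cong (λ b → u * (qpoch b (suc m) * 1/qfac (+ suc m))) (bottom t (+ m)) ⟩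
      u * (qpoch a (suc m) * 1/qfac (+ suc m))
        ≡⟨ cong (λ p → u * (p * 1/qfac (+ suc m))) (qpoch-snoc a m) ⟩
      u * (qpoch a m * (1ℚ - q^ (a ℤ.+ + m)) * 1/qfac (+ suc m))
        ≡⟨ cong (λ z → u * (qpoch a m * (1ℚ - q^ z) * 1/qfac (+ suc m))) (top t (+ m)) ⟩
      u * (qpoch a m * (1ℚ - q^ (+ 1 ℤ.+ t)) * 1/qfac (+ suc m))
        ≡⟨ regroup u (qpoch a m) (1ℚ - q^ (+ 1 ℤ.+ t)) (1/qfac (+ suc m)) ⟩
      (1ℚ - q^ (+ 1 ℤ.+ t)) * (qpoch a m * (u * 1/qfac (+ suc m)))
        ≡⟨ cong (λ r → (1ℚ - q^ (+ 1 ℤ.+ t)) * (qpoch a m * r)) (sym (1/qfac-step (+ m))) ⟩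
      (1ℚ - q^ (+ 1 ℤ.+ t)) * (qpoch a m * 1/qfac (+ m)) ∎
      where
      u  = 1ℚ - q^ (+ suc m)
      a′ = ((+ 1 ℤ.+ t) ℤ.- + suc m) ℤ.+ + 1
      a  = (t ℤ.- + m) ℤ.+ + 1
      bottom : ∀ t m → ((+ 1 ℤ.+ t) ℤ.- (+ 1 ℤ.+ m)) ℤ.+ + 1 ≡ (t ℤ.- m) ℤ.+ + 1
      bottom = ℤ-solve-∀
      top : ∀ t m → (t ℤ.- m) ℤ.+ + 1 ℤ.+ m ≡ + 1 ℤ.+ t
      top = ℤ-solve-∀
      regroup : ∀ u p v r → u * (p * v * r) ≡ v * (p * (u * r))
      regroup = solve-∀ ℚ-ring

    qbinom-suc : ∀ t m → (1ℚ - q^ (+ suc m)) * qbinom q t (+ suc m) ≡ (1ℚ - q^ (t ℤ.- + m)) * qbinom q t (+ m)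
    qbinom-suc t m = begin
      u * (qpoch b (suc m) * 1/qfac (+ suc m))
        ≡⟨ cong (λ p → u * (p * 1/qfac (+ suc m))) (qpoch-cons b m) ⟩
      u * ((1ℚ - q^ b) * qpoch (+ 1 ℤ.+ b) m * 1/qfac (+ suc m))
        ≡⟨ cong₂ (λ x y → u * ((1ℚ - q^ x) * qpoch y m * 1/qfac (+ suc m))) (lower t (+ m)) (lower′ t (+ m)) ⟩
      u * ((1ℚ - q^ (t ℤ.- + m)) * qpoch a m * 1/qfac (+ suc m))
        ≡⟨ regroup u (1ℚ - q^ (t ℤ.- + m)) (qpoch a m) (1/qfac (+ suc m)) ⟩
      (1ℚ - q^ (t ℤ.- + m)) * (qpoch a m * (u * 1/qfac (+ suc m)))
        ≡⟨ cong (λ r → (1ℚ - q^ (t ℤ.- + m)) * (qpoch a m * r)) (sym (1/qfac-step (+ m))) ⟩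
      (1ℚ - q^ (t ℤ.- + m)) * (qpoch a m * 1/qfac (+ m)) ∎
      where
      u = 1ℚ - q^ (+ suc m)
      a = (t ℤ.- + m) ℤ.+ + 1
      b = (t ℤ.- + suc m) ℤ.+ + 1
      lower : ∀ t m → (t ℤ.- (+ 1 ℤ.+ m)) ℤ.+ + 1 ≡ t ℤ.- m
      lower = ℤ-solve-∀
      lower′ : ∀ t m → + 1 ℤ.+ ((t ℤ.- (+ 1 ℤ.+ m)) ℤ.+ + 1) ≡ (t ℤ.- m) ℤ.+ + 1
      lower′ = ℤ-solve-∀
      regroup : ∀ u v p r → u * (v * p * r) ≡ v * (p * (u * r))
      regroup = solve-∀ ℚ-ring

    qbinom-trinomial : ∀ L m n → qbinom q (L ℤ.- + n) (+ m) * qbinom q L (+ n)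
                               ≡ qpoch (+ 1 ℤ.+ (L ℤ.- + m ℤ.- + n)) (m ℕ.+ n) * (1/qfac (+ m) * 1/qfac (+ n))
    qbinom-trinomial L m n = begin
      qpoch x₁ m * 1/qfac (+ m) * (qpoch x₂ n * 1/qfac (+ n))
        ≡⟨ regroup (qpoch x₁ m) (1/qfac (+ m)) (qpoch x₂ n) (1/qfac (+ n)) ⟩
      qpoch x₁ m * qpoch x₂ n * (1/qfac (+ m) * 1/qfac (+ n))
        ≡⟨ cong₂ (λ y z → qpoch y m * qpoch z n * (1/qfac (+ m) * 1/qfac (+ n))) (first L (+ m) (+ n)) (second L (+ m) (+ n)) ⟩
      qpoch x m * qpoch (x ℤ.+ + m) n * (1/qfac (+ m) * 1/qfac (+ n))
        ≡⟨ cong (_* (1/qfac (+ m) * 1/qfac (+ n))) (sym (qpoch-+ x m n)) ⟩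
      qpoch x (m ℕ.+ n) * (1/qfac (+ m) * 1/qfac (+ n)) ∎
      where
      x  = + 1 ℤ.+ (L ℤ.- + m ℤ.- + n)
      x₁ = ((L ℤ.- + n) ℤ.- + m) ℤ.+ + 1
      x₂ = (L ℤ.- + n) ℤ.+ + 1
      first : ∀ L m n → ((L ℤ.- n) ℤ.- m) ℤ.+ + 1 ≡ + 1 ℤ.+ (L ℤ.- m ℤ.- n)
      first = ℤ-solve-∀
      second : ∀ L m n → (L ℤ.- n) ℤ.+ + 1 ≡ + 1 ℤ.+ (L ℤ.- m ℤ.- n) ℤ.+ m
      second = ℤ-solve-∀
      regroup : ∀ p r p′ r′ → p * r * (p′ * r′) ≡ p * p′ * (r * r′)
      regroup = solve-∀ ℚ-ring

    qmultinom-ℕ : ∀ M s a b → qmultinom q M (+ s ∷ + a ∷ + b ∷ [])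
                             ≡ qpoch (+ 1 ℤ.+ M ℤ.- (+ s ℤ.+ + a ℤ.+ + b)) (s ℕ.+ a ℕ.+ b)
                               * (1/qfac (+ s) * 1/qfac (+ a) * 1/qfac (+ b))
    qmultinom-ℕ M s a b = cong₂ _*_
      (cong₂ (λ z n → qpoch (+ 1 ℤ.+ M ℤ.- z) n) (sum≡ (+ s) (+ a) (+ b)) (length≡ s a b))
      (begin
        inv (qfac s * (qfac a * (qfac b * 1ℚ)))            ≡⟨ inv-distrib-* (qfac s) _ ⟩
        inv (qfac s) * inv (qfac a * (qfac b * 1ℚ))        ≡⟨ cong (inv (qfac s) *_) (inv-distrib-* (qfac a) _) ⟩
        inv (qfac s) * (inv (qfac a) * inv (qfac b * 1ℚ))
          ≡⟨ cong (λ r → inv (qfac s) * (inv (qfac a) * r)) (inv-distrib-* (qfac b) 1ℚ) ⟩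
        inv (qfac s) * (inv (qfac a) * (inv (qfac b) * 1ℚ)) ≡⟨ regroup (inv (qfac s)) (inv (qfac a)) (inv (qfac b)) ⟩
        inv (qfac s) * inv (qfac a) * inv (qfac b)          ∎)
      where
      sum≡ : ∀ s a b → s ℤ.+ (a ℤ.+ (b ℤ.+ + 0)) ≡ s ℤ.+ a ℤ.+ b
      sum≡ = ℤ-solve-∀
      length≡ : ∀ s a b → s ℕ.+ (a ℕ.+ (b ℕ.+ 0)) ≡ s ℕ.+ a ℕ.+ b
      length≡ = ℕ-solve-∀
      regroup : ∀ x y z → x * (y * (z * 1ℚ)) ≡ x * y * z
      regroup = solve-∀ ℚ-ring

    F-vanishes : ∀ i j k L s → OutOfRange (+ i) (+ j) (+ k) s → F i j k L s ≡ 0ℚ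
    F-vanishes i j k L s out =
      trans (cong (prefix *_) (product₄-zero {1/qfac (+ s)} (inj₂ (vanishing-factor out)))) (ℚ.*-zeroʳ prefix)
      where
      prefix = q^ E (+ i) (+ j) (+ k) L (+ s)
               * qpoch (+ 1 ℤ.+ (N (+ i) (+ j) (+ k) L ℤ.+ + s)) ((i ℕ.+ j ℕ.+ k) ℕ.∸ (s ℕ.+ s))
      vanishing-factor : OutOfRange (+ i) (+ j) (+ k) s →
        1/qfac (+ i ℤ.- + s) ≡ 0ℚ ⊎ 1/qfac (+ j ℤ.- + s) ≡ 0ℚ ⊎ 1/qfac (+ k ℤ.- + s) ≡ 0ℚ
      vanishing-factor (inj₁ neg)        = inj₁ (1/qfac-negative _ neg)
      vanishing-factor (inj₂ (inj₁ neg)) = inj₂ (inj₁ (1/qfac-negative _ neg))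
      vanishing-factor (inj₂ (inj₂ neg)) = inj₂ (inj₂ (1/qfac-negative _ neg))

    G-vanishes : ∀ i j k L s → 1/qfac (+ s ℤ.- + 1) ≡ 0ℚ ⊎ 1/qfac (+ suc i ℤ.- + s) ≡ 0ℚ → G i j k L s ≡ 0ℚ
    G-vanishes i j k L s out = trans (cong (prefix *_) (product₄-zero (vanishing-factor out))) (ℚ.*-zeroʳ prefix)
      where
      Y = q^ (+ i ℤ.+ + j ℤ.+ + 2 ℤ.- + s)
      prefix = - (Y * (1ℚ - Y)) * q^ E (+ i) (+ j) (+ k) L (+ s)
               * qpoch (N (+ i) (+ j) (+ k) L ℤ.+ + s) ((i ℕ.+ j ℕ.+ k ℕ.+ 2) ℕ.∸ (s ℕ.+ s))
      vanishing-factor : 1/qfac (+ s ℤ.- + 1) ≡ 0ℚ ⊎ 1/qfac (+ suc i ℤ.- + s) ≡ 0ℚ →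
        1/qfac (+ s ℤ.- + 1) ≡ 0ℚ ⊎ 1/qfac (+ suc i ℤ.- + s) ≡ 0ℚ
          ⊎ 1/qfac (+ suc j ℤ.- + s) ≡ 0ℚ ⊎ 1/qfac (+ k ℤ.- + s) ≡ 0ℚ
      vanishing-factor (inj₁ r≡0) = inj₁ r≡0
      vanishing-factor (inj₂ r≡0) = inj₂ (inj₁ r≡0)

    module Telescoping (i j k : ℕ) (L : ℤ) (s : ℕ) where

      S a b c n : ℤ
      S = + s
      a = + i ℤ.- S
      b = + j ℤ.- S
      c = + k ℤ.- S
      n = N (+ i) (+ j) (+ k) L ℤ.+ S

      -- Q = q^ (+ 1) is q * 1ℚ rather than q; keeping it as an atom lets
      -- q^-split produce the monomials below literally.
      Q A B C X P e long short r₀ rᵢ rⱼ rₖ : ℚ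
      Q  = q^ (+ 1)
      A  = q^ a
      B  = q^ b
      C  = q^ c
      X  = q^ S
      P  = q^ n
      e  = q^ E (+ i) (+ j) (+ k) L S
      long = qpoch n ((i ℕ.+ j ℕ.+ k ℕ.+ 2) ℕ.∸ (s ℕ.+ s))
      short = qpoch (+ 1 ℤ.+ n) ((i ℕ.+ j ℕ.+ k) ℕ.∸ (s ℕ.+ s))
      r₀ = 1/qfac S
      rᵢ = 1/qfac (+ suc i ℤ.- S)
      rⱼ = 1/qfac (+ suc j ℤ.- S)
      rₖ = 1/qfac c

      1/qfac-lower : ∀ I → 1/qfac (+ I ℤ.- S) ≡ (1ℚ - Q * q^ (+ I ℤ.- S)) * 1/qfac (+ suc I ℤ.- S)
      1/qfac-lower I = trans (1/qfac-step′ (+ I ℤ.- S) (shift (+ I) S))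
        (cong (λ x → (1ℚ - x) * 1/qfac (+ suc I ℤ.- S)) (q^-split (+ 1) (+ I ℤ.- S ∷ []) (sym (shift (+ I) S))))
        where
        shift : ∀ I S → + 1 ℤ.+ (I ℤ.- S) ≡ (+ 1 ℤ.+ I) ℤ.- S
        shift = ℤ-solve-∀

      c₁-atoms : c₁ i j ≡ (1ℚ - Q * A * X) * (1ℚ - Q * B * X)
      c₁-atoms = cong₂ (λ u v → (1ℚ - u) * (1ℚ - v))
        (q^-split (+ 1) (a ∷ S ∷ []) (split (+ i) S)) (q^-split (+ 1) (b ∷ S ∷ []) (split (+ j) S))
        where
        split : ∀ I S → + 1 ℤ.+ I ≡ + 1 ℤ.+ (I ℤ.- S) ℤ.+ S
        split = ℤ-solve-∀

      c₂-atoms : c₂ i j k L ≡ Q * Q * A * B * X * X * (1ℚ - Q * P * A * B * X) * (1ℚ - P * C)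
      c₂-atoms = cong₂ _*_
        (cong₂ (λ u v → u * (1ℚ - v))
          (q^-split (+ 1) (+ 1 ∷ a ∷ b ∷ S ∷ S ∷ []) (split₁ (+ i) (+ j) S))
          (q^-split (+ 1) (n ∷ a ∷ b ∷ S ∷ []) (split₂ L (+ i) (+ j) (+ k) S)))
        (cong (λ v → 1ℚ - v) (q^-split n (c ∷ []) (split₃ L (+ i) (+ j) (+ k) S)))
        where
        split₁ : ∀ I J S → I ℤ.+ J ℤ.+ + 2 ≡ + 1 ℤ.+ + 1 ℤ.+ (I ℤ.- S) ℤ.+ (J ℤ.- S) ℤ.+ S ℤ.+ S
        split₁ = ℤ-solve-∀
        split₂ : ∀ L I J K S →
          + 1 ℤ.+ (L ℤ.- K) ≡ + 1 ℤ.+ (L ℤ.- I ℤ.- J ℤ.- K ℤ.+ S) ℤ.+ (I ℤ.- S) ℤ.+ (J ℤ.- S) ℤ.+ S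
        split₂ = ℤ-solve-∀
        split₃ : ∀ L I J K S → L ℤ.- I ℤ.- J ≡ L ℤ.- I ℤ.- J ℤ.- K ℤ.+ S ℤ.+ (K ℤ.- S)
        split₃ = ℤ-solve-∀

      F-shift-atoms : F (suc i) (suc j) k (+ 1 ℤ.+ L) s ≡ e * Q * Q * A * B * X * long * (r₀ * rᵢ * rⱼ * rₖ)
      F-shift-atoms = cong₂ (λ x p → x * p * (r₀ * rᵢ * rⱼ * rₖ))
        (q^-split (E (+ i) (+ j) (+ k) L S) (+ 1 ∷ + 1 ∷ a ∷ b ∷ S ∷ []) (E-shift (+ i) (+ j) (+ k) L S))
        (cong₂ qpoch (base L (+ i) (+ j) (+ k) S) (cong (ℕ._∸ (s ℕ.+ s)) (length i j k)))
        where
        base : ∀ L I J K S →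
          + 1 ℤ.+ ((+ 1 ℤ.+ L) ℤ.- (+ 1 ℤ.+ I) ℤ.- (+ 1 ℤ.+ J) ℤ.- K ℤ.+ S) ≡ L ℤ.- I ℤ.- J ℤ.- K ℤ.+ S
        base = ℤ-solve-∀
        length : ∀ i j k → suc i ℕ.+ suc j ℕ.+ k ≡ i ℕ.+ j ℕ.+ k ℕ.+ 2
        length = ℕ-solve-∀

      F-atoms : F i j k L s ≡ e * short * (r₀ * ((1ℚ - Q * A) * rᵢ) * ((1ℚ - Q * B) * rⱼ) * rₖ)
      F-atoms = cong₂ (λ u v → e * short * (r₀ * u * v * rₖ)) (1/qfac-lower i) (1/qfac-lower j)

      G-atoms : G i j k L s ≡ - (Q * Q * A * B * X * (1ℚ - Q * Q * A * B * X)) * e * long * ((1ℚ - X) * r₀ * rᵢ * rⱼ * rₖ)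
      G-atoms = cong₂ (λ y r → - (y * (1ℚ - y)) * e * long * (r * rᵢ * rⱼ * rₖ))
        (q^-split (+ 1) (+ 1 ∷ a ∷ b ∷ S ∷ []) (split (+ i) (+ j) S))
        (1/qfac-step′ (S ℤ.- + 1) (cancel S))
        where
        split : ∀ I J S → I ℤ.+ J ℤ.+ + 2 ℤ.- S ≡ + 1 ℤ.+ + 1 ℤ.+ (I ℤ.- S) ℤ.+ (J ℤ.- S) ℤ.+ S
        split = ℤ-solve-∀
        cancel : ∀ S → + 1 ℤ.+ (S ℤ.- + 1) ≡ S
        cancel = ℤ-solve-∀

      G-suc-atoms : G i j k L (suc s) ≡ - (Q * A * B * X * (1ℚ - Q * A * B * X)) * (e * Q * P * X) * short
                                        * (r₀ * ((1ℚ - Q * A) * rᵢ) * ((1ℚ - Q * B) * rⱼ) * ((1ℚ - C) * rₖ))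
      G-suc-atoms = cong₂ _*_ (cong₂ _*_ (cong₂ _*_ (cong (λ y → - (y * (1ℚ - y))) Y≡) e≡) short≡) weights≡
        where
        split : ∀ I J S → I ℤ.+ J ℤ.+ + 2 ℤ.- (+ 1 ℤ.+ S) ≡ + 1 ℤ.+ (I ℤ.- S) ℤ.+ (J ℤ.- S) ℤ.+ S
        split = ℤ-solve-∀
        Y≡ = q^-split (+ 1) (a ∷ b ∷ S ∷ []) (split (+ i) (+ j) S)
        e≡ = q^-split (E (+ i) (+ j) (+ k) L S) (+ 1 ∷ n ∷ S ∷ []) (E-suc (+ i) (+ j) (+ k) L S)
        shift : ∀ M S → M ℤ.+ (+ 1 ℤ.+ S) ≡ + 1 ℤ.+ (M ℤ.+ S)
        shift = ℤ-solve-∀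
        short≡ = cong₂ qpoch (shift (N (+ i) (+ j) (+ k) L) S)
                          (cong₂ ℕ._∸_ (ℕ.+-comm (i ℕ.+ j ℕ.+ k) 2) (cong suc (ℕ.+-suc s s)))
        cancel₁ : ∀ S → (+ 1 ℤ.+ S) ℤ.- + 1 ≡ S
        cancel₁ = ℤ-solve-∀
        cancel₂ : ∀ I S → (+ 1 ℤ.+ I) ℤ.- (+ 1 ℤ.+ S) ≡ I ℤ.- S
        cancel₂ = ℤ-solve-∀
        cancel₃ : ∀ K S → + 1 ℤ.+ (K ℤ.- (+ 1 ℤ.+ S)) ≡ K ℤ.- S
        cancel₃ = ℤ-solve-∀
        lowered : ∀ I → 1/qfac (+ suc I ℤ.- + suc s) ≡ (1ℚ - Q * q^ (+ I ℤ.- S)) * 1/qfac (+ suc I ℤ.- S)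
        lowered I = trans (cong 1/qfac (cancel₂ (+ I) S)) (1/qfac-lower I)
        weights≡ = cong₂ _*_ (cong₂ _*_ (cong₂ _*_ (cong 1/qfac (cancel₁ S)) (lowered i)) (lowered j))
                             (1/qfac-step′ (+ k ℤ.- (+ 1 ℤ.+ S)) (cancel₃ (+ k) S))

      weights long′ : ℚ
      weights = r₀ * ((1ℚ - Q * A) * rᵢ) * ((1ℚ - Q * B) * rⱼ) * rₖ
      long′ = (1ℚ - P) * (short * (1ℚ - Q * P * A * B * C * X))

      long-split : s ℕ.≤ i → s ℕ.≤ j → s ℕ.≤ k → long ≡ long′
      long-split s≤i s≤j s≤k = begin
        long                                                ≡⟨ cong (qpoch n) length≡ ⟩
        qpoch n (suc (suc r))                             ≡⟨ qpoch-cons n (suc r) ⟩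
        (1ℚ - P) * qpoch (+ 1 ℤ.+ n) (suc r)              ≡⟨ cong ((1ℚ - P) *_) (qpoch-snoc (+ 1 ℤ.+ n) r) ⟩
        (1ℚ - P) * (short * (1ℚ - q^ (+ 1 ℤ.+ n ℤ.+ + r)))   ≡⟨ cong (λ x → (1ℚ - P) * (short * (1ℚ - x))) top≡ ⟩
        long′                                               ∎
        where
        r = (i ℕ.+ j ℕ.+ k) ℕ.∸ (s ℕ.+ s)
        2s≤ : s ℕ.+ s ℕ.≤ i ℕ.+ j ℕ.+ k
        2s≤ = ℕ.≤-trans (ℕ.+-mono-≤ s≤i s≤j) (ℕ.m≤m+n (i ℕ.+ j) k)
        length≡ : (i ℕ.+ j ℕ.+ k ℕ.+ 2) ℕ.∸ (s ℕ.+ s) ≡ suc (suc r)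
        length≡ = trans (ℕ.+-∸-comm 2 2s≤) (ℕ.+-comm r 2)
        r≡ : + r ≡ + (i ℕ.+ j ℕ.+ k) ℤ.- + (s ℕ.+ s)
        r≡ = sym (trans (ℤ.[+m]-[+n]≡m⊖n (i ℕ.+ j ℕ.+ k) (s ℕ.+ s)) (ℤ.⊖-≥ 2s≤))
        split : ∀ L I J K S → + 1 ℤ.+ (L ℤ.- I ℤ.- J ℤ.- K ℤ.+ S) ℤ.+ (I ℤ.+ J ℤ.+ K ℤ.- (S ℤ.+ S))
                              ≡ + 1 ℤ.+ (L ℤ.- I ℤ.- J ℤ.- K ℤ.+ S) ℤ.+ (I ℤ.- S) ℤ.+ (J ℤ.- S) ℤ.+ (K ℤ.- S) ℤ.+ S
        split = ℤ-solve-∀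
        top≡ = q^-split (+ 1) (n ∷ a ∷ b ∷ c ∷ S ∷ [])
                 (trans (cong (λ z → + 1 ℤ.+ n ℤ.+ z) r≡) (split L (+ i) (+ j) (+ k) S))

      lowered-vanishes : ∀ I → ¬ s ℕ.≤ I → (1ℚ - Q * q^ (+ I ℤ.- S)) * 1/qfac (+ suc I ℤ.- S) ≡ 0ℚ
      lowered-vanishes I s≰I = trans (sym (1/qfac-lower I)) (1/qfac-negative _ ([+m]-[+n]-negative (ℕ.≰⇒> s≰I)))

      weights-vanish : r₀ ≡ 0ℚ ⊎ (1ℚ - Q * A) * rᵢ ≡ 0ℚ ⊎ (1ℚ - Q * B) * rⱼ ≡ 0ℚ ⊎ rₖ ≡ 0ℚ →
                       weights * (long - long′) ≡ 0ℚ
      weights-vanish factor≡0 = trans (cong (_* (long - long′)) (product₄-zero factor≡0)) (ℚ.*-zeroˡ (long - long′))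

      -- The certificate identity holds up to this multiple of long - long′: for
      -- s ≤ i, j, k the Pochhammer symbol long splits as long′, and otherwise
      -- one of the reciprocal factorials in `weights` vanishes.
      remainder-vanishes : weights * (long - long′) ≡ 0ℚ
      remainder-vanishes with s ℕ.≤? i | s ℕ.≤? j | s ℕ.≤? k
      ... | yes s≤i | yes s≤j | yes s≤k = begin
        weights * (long - long′)    ≡⟨ cong (λ l → weights * (l - long′)) (long-split s≤i s≤j s≤k) ⟩
        weights * (long′ - long′)   ≡⟨ cong (weights *_) (ℚ.+-inverseʳ long′) ⟩
        weights * 0ℚ            ≡⟨ ℚ.*-zeroʳ weights ⟩
        0ℚ                      ∎
      ... | no s≰i | _      | _      = weights-vanish (inj₂ (inj₁ (lowered-vanishes i s≰i)))
      ... | yes _  | no s≰j | _      = weights-vanish (inj₂ (inj₂ (inj₁ (lowered-vanishes j s≰j))))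
      ... | yes _  | yes _  | no s≰k =
        weights-vanish (inj₂ (inj₂ (inj₂ (1/qfac-negative c ([+m]-[+n]-negative (ℕ.≰⇒> s≰k))))))

      telescoping : c₁ i j * F (suc i) (suc j) k (+ 1 ℤ.+ L) s - c₂ i j k L * F i j k L s ≡ G i j k L (suc s) - G i j k L s
      telescoping = begin
        c₁ i j * F (suc i) (suc j) k (+ 1 ℤ.+ L) s - c₂ i j k L * F i j k L s
          ≡⟨ cong₂ _-_ (cong₂ _*_ c₁-atoms F-shift-atoms) (cong₂ _*_ c₂-atoms F-atoms) ⟩
        _ ≡⟨ certificate-identity Q A B C X P e long short r₀ rᵢ rⱼ rₖ ⟩
        _ ≡⟨ cong₂ _+_ (sym (cong₂ _-_ G-suc-atoms G-atoms))
                       (trans (cong (Q * Q * A * B * X * X * e *_) remainder-vanishes) (ℚ.*-zeroʳ (Q * Q * A * B * X * X * e))) ⟩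
        G i j k L (suc s) - G i j k L s + 0ℚ
          ≡⟨ ℚ.+-identityʳ _ ⟩
        G i j k L (suc s) - G i j k L s ∎

    sumF-recurrence : ∀ i j k L → c₁ i j * sumF (suc i) (suc j) k (+ 1 ℤ.+ L) ≡ c₂ i j k L * sumF i j k L
    sumF-recurrence i j k L = x-y≡0⇒x≡y _ _ (begin
      c₁ i j * Σ≤ (suc i) F′ - c₂ i j k L * sumF i j k L
        ≡⟨ cong (λ t → c₁ i j * Σ≤ (suc i) F′ - c₂ i j k L * t) (sym extend) ⟩
      c₁ i j * Σ≤ (suc i) F′ - c₂ i j k L * Σ≤ (suc i) (F i j k L)
        ≡⟨ sym (Σ≤-linear (suc i) F′ (F i j k L) (c₁ i j) (c₂ i j k L)) ⟩
      Σ≤ (suc i) (λ s → c₁ i j * F′ s - c₂ i j k L * F i j k L s)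
        ≡⟨ Σ≤-cong (suc i) (Telescoping.telescoping i j k L) ⟩
      Σ≤ (suc i) (λ s → G i j k L (suc s) - G i j k L s)
        ≡⟨ Σ≤-telescope (suc i) (G i j k L) ⟩
      G i j k L (2 ℕ.+ i) - G i j k L 0
        ≡⟨ cong₂ _-_ (G-vanishes i j k L (2 ℕ.+ i) (inj₂ (1/qfac-negative _ ([+m]-[+n]-negative (ℕ.n<1+n (suc i))))))
                     (G-vanishes i j k L 0 (inj₁ refl)) ⟩
      0ℚ - 0ℚ
        ≡⟨⟩
      0ℚ ∎)
      where
      F′ = F (suc i) (suc j) k (+ 1 ℤ.+ L)
      extend : Σ≤ (suc i) (F i j k L) ≡ sumF i j k L
      extend = trans (cong (λ x → sumF i j k L + x) (F-vanishes i j k L (suc i) (inj₁ ([+m]-[+n]-negative (ℕ.n<1+n i)))))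
                     (ℚ.+-identityʳ (sumF i j k L))

    binomProduct-recurrence : ∀ i j k L →
      c₁ i j * binomProduct (+ suc i) (+ suc j) (+ k) (+ 1 ℤ.+ L) ≡ c₂ i j k L * binomProduct (+ i) (+ j) (+ k) L
    binomProduct-recurrence i j k L = begin
      (1ℚ - q^ (+ suc i)) * (1ℚ - q^ (+ suc j)) * (q^ τ′ * B₁′ * B₂′ * B₃′)
        ≡⟨ regroup₁ (1ℚ - q^ (+ suc i)) (1ℚ - q^ (+ suc j)) (q^ τ′) B₁′ B₂′ B₃′ ⟩
      (1ℚ - q^ (+ suc i)) * B₁′ * ((1ℚ - q^ (+ suc j)) * B₂′) * (q^ τ′ * B₃′)
        ≡⟨ cong₂ _*_ (cong₂ _*_ first second) (cong₂ _*_ τ-shift third) ⟩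
      α * B₁ * (β * B₂) * (q^ τ * Z * B₃)
        ≡⟨ regroup₂ α B₁ β B₂ (q^ τ) Z B₃ ⟩
      Z * α * β * (q^ τ * B₁ * B₂ * B₃) ∎
      where
      τ  = T (+ i) ℤ.+ T (+ j) ℤ.+ T (+ k)
      τ′ = T (+ suc i) ℤ.+ T (+ suc j) ℤ.+ T (+ k)
      Z  = q^ (+ i ℤ.+ + j ℤ.+ + 2)
      α  = 1ℚ - q^ (+ 1 ℤ.+ (L ℤ.- + k))
      β  = 1ℚ - q^ (L ℤ.- + i ℤ.- + j)
      B₁′ = qbinom q ((+ 1 ℤ.+ L) ℤ.- + k) (+ suc i)
      B₂′ = qbinom q ((+ 1 ℤ.+ L) ℤ.- + suc i) (+ suc j)
      B₃′ = qbinom q ((+ 1 ℤ.+ L) ℤ.- + suc j) (+ k)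
      B₁ = qbinom q (L ℤ.- + k) (+ i)
      B₂ = qbinom q (L ℤ.- + i) (+ j)
      B₃ = qbinom q (L ℤ.- + j) (+ k)
      shift : ∀ L K → (+ 1 ℤ.+ L) ℤ.- K ≡ + 1 ℤ.+ (L ℤ.- K)
      shift = ℤ-solve-∀
      cancel : ∀ L I → (+ 1 ℤ.+ L) ℤ.- (+ 1 ℤ.+ I) ≡ L ℤ.- I
      cancel = ℤ-solve-∀
      first : (1ℚ - q^ (+ suc i)) * B₁′ ≡ α * B₁
      first = trans (cong (λ t → (1ℚ - q^ (+ suc i)) * qbinom q t (+ suc i)) (shift L (+ k))) (qbinom-suc-suc (L ℤ.- + k) i)
      second : (1ℚ - q^ (+ suc j)) * B₂′ ≡ β * B₂
      second = trans (cong (λ t → (1ℚ - q^ (+ suc j)) * qbinom q t (+ suc j)) (cancel L (+ i))) (qbinom-suc (L ℤ.- + i) j)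
      third : B₃′ ≡ B₃
      third = cong (λ t → qbinom q t (+ k)) (cancel L (+ j))
      exponent : ∀ tᵢ tⱼ tₖ I J →
        tᵢ ℤ.+ (+ 1 ℤ.+ I) ℤ.+ (tⱼ ℤ.+ (+ 1 ℤ.+ J)) ℤ.+ tₖ ≡ tᵢ ℤ.+ tⱼ ℤ.+ tₖ ℤ.+ (I ℤ.+ J ℤ.+ + 2)
      exponent = ℤ-solve-∀
      τ-shift : q^ τ′ ≡ q^ τ * Z
      τ-shift = q^-split τ (+ i ℤ.+ + j ℤ.+ + 2 ∷ [])
        (trans (cong₂ (λ u v → u ℤ.+ v ℤ.+ T (+ k)) (T-suc (+ i)) (T-suc (+ j)))
               (exponent (T (+ i)) (T (+ j)) (T (+ k)) (+ i) (+ j)))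
      regroup₁ : ∀ u v t x y z → u * v * (t * x * y * z) ≡ u * x * (v * y) * (t * z)
      regroup₁ = solve-∀ ℚ-ring
      regroup₂ : ∀ α x β y t Z z → α * x * (β * y) * (t * Z * z) ≡ Z * α * β * (t * x * y * z)
      regroup₂ = solve-∀ ℚ-ring

    c₁-≢0 : ∀ i j → c₁ i j ≢ 0ℚ
    c₁-≢0 i j = *-≢0 (1-q^suc≢0 i) (1-q^suc≢0 j)

    F-at-0 : ∀ i j k L →
      F i j k L 0 ≡ q^ (T (+ i) ℤ.+ T (+ j) ℤ.+ T (+ k)) * qpoch (+ 1 ℤ.+ N (+ i) (+ j) (+ k) L) (i ℕ.+ j ℕ.+ k)
                    * (1/qfac (+ i) * 1/qfac (+ j) * 1/qfac (+ k))
    F-at-0 i j k L = cong₂ _*_ (cong₂ _*_ (cong q^_ exponent) (cong (λ x → qpoch x (i ℕ.+ j ℕ.+ k)) base)) weights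
      where
      +m-0≡+m : ∀ m → + m ℤ.- + 0 ≡ + m
      +m-0≡+m m = cong +_ (ℕ.+-identityʳ m)
      drop-zero : ∀ L a b c → + 0 ℤ.* (L ℤ.+ + 2) ℤ.- + 0 ℤ.+ a ℤ.+ b ℤ.+ c ≡ a ℤ.+ b ℤ.+ c
      drop-zero = ℤ-solve-∀
      exponent : E (+ i) (+ j) (+ k) L (+ 0) ≡ T (+ i) ℤ.+ T (+ j) ℤ.+ T (+ k)
      exponent = trans
        (cong₂ ℤ._+_ (cong₂ ℤ._+_ (cong (λ t → + 0 ℤ.* (L ℤ.+ + 2) ℤ.- T (+ 0) ℤ.+ t) (cong T (+m-0≡+m i)))
                                  (cong T (+m-0≡+m j)))
                     (cong T (+m-0≡+m k)))
        (drop-zero L (T (+ i)) (T (+ j)) (T (+ k)))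
      base : + 1 ℤ.+ (N (+ i) (+ j) (+ k) L ℤ.+ + 0) ≡ + 1 ℤ.+ N (+ i) (+ j) (+ k) L
      base = cong (λ x → + 1 ℤ.+ x) (ℤ.+-identityʳ (N (+ i) (+ j) (+ k) L))
      drop-one : ∀ x y z → 1ℚ * x * y * z ≡ x * y * z
      drop-one = solve-∀ ℚ-ring
      weights : 1/qfac (+ 0) * 1/qfac (+ i ℤ.- + 0) * 1/qfac (+ j ℤ.- + 0) * 1/qfac (+ k ℤ.- + 0)
                ≡ 1/qfac (+ i) * 1/qfac (+ j) * 1/qfac (+ k)
      weights = trans
        (cong₂ _*_ (cong₂ _*_ (cong (1ℚ *_) (cong 1/qfac (+m-0≡+m i))) (cong 1/qfac (+m-0≡+m j))) (cong 1/qfac (+m-0≡+m k)))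
        (drop-one (1/qfac (+ i)) (1/qfac (+ j)) (1/qfac (+ k)))

    sumF-at-i≡0 : ∀ j k L → sumF 0 j k L ≡ binomProduct (+ 0) (+ j) (+ k) L
    sumF-at-i≡0 j k L = begin
      F 0 j k L 0
        ≡⟨ F-at-0 0 j k L ⟩
      q^ τ * qpoch (+ 1 ℤ.+ N (+ 0) (+ j) (+ k) L) (j ℕ.+ k) * (1ℚ * 1/qfac (+ j) * 1/qfac (+ k))
        ≡⟨ cong₂ (λ x m → q^ τ * qpoch x m * (1ℚ * 1/qfac (+ j) * 1/qfac (+ k))) (base L (+ j) (+ k)) (ℕ.+-comm j k) ⟩
      q^ τ * qpoch (+ 1 ℤ.+ (L ℤ.- + k ℤ.- + j)) (k ℕ.+ j) * (1ℚ * 1/qfac (+ j) * 1/qfac (+ k))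
        ≡⟨ regroup₁ (q^ τ) (qpoch (+ 1 ℤ.+ (L ℤ.- + k ℤ.- + j)) (k ℕ.+ j)) (1/qfac (+ j)) (1/qfac (+ k)) ⟩
      q^ τ * (qpoch (+ 1 ℤ.+ (L ℤ.- + k ℤ.- + j)) (k ℕ.+ j) * (1/qfac (+ k) * 1/qfac (+ j)))
        ≡⟨ cong (q^ τ *_) (sym (qbinom-trinomial L k j)) ⟩
      q^ τ * (qbinom q (L ℤ.- + j) (+ k) * qbinom q L (+ j))
        ≡⟨ regroup₂ (q^ τ) (qbinom q (L ℤ.- + j) (+ k)) (qbinom q L (+ j)) ⟩
      q^ τ * 1ℚ * qbinom q L (+ j) * qbinom q (L ℤ.- + j) (+ k)
        ≡⟨ cong (λ t → q^ τ * 1ℚ * qbinom q t (+ j) * qbinom q (L ℤ.- + j) (+ k)) (sym (ℤ.+-identityʳ L)) ⟩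
      binomProduct (+ 0) (+ j) (+ k) L ∎
      where
      τ = T (+ 0) ℤ.+ T (+ j) ℤ.+ T (+ k)
      base : ∀ L J K → + 1 ℤ.+ (L ℤ.- + 0 ℤ.- J ℤ.- K) ≡ + 1 ℤ.+ (L ℤ.- K ℤ.- J)
      base = ℤ-solve-∀
      regroup₁ : ∀ t p x y → t * p * (1ℚ * x * y) ≡ t * (p * (y * x))
      regroup₁ = solve-∀ ℚ-ring
      regroup₂ : ∀ t x y → t * (x * y) ≡ t * 1ℚ * y * x
      regroup₂ = solve-∀ ℚ-ring

    sumF-at-j≡0 : ∀ i k L → sumF i 0 k L ≡ binomProduct (+ i) (+ 0) (+ k) L
    sumF-at-j≡0 i k L = begin
      Σ≤ i (F i 0 k L)
        ≡⟨ Σ≤-head i (F i 0 k L) (λ s → F-vanishes i 0 k L (suc s) (inj₂ (inj₁ ([+m]-[+n]-negative ℕ.z<s)))) ⟩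
      F i 0 k L 0
        ≡⟨ F-at-0 i 0 k L ⟩
      q^ τ * qpoch (+ 1 ℤ.+ N (+ i) (+ 0) (+ k) L) (i ℕ.+ 0 ℕ.+ k) * (1/qfac (+ i) * 1ℚ * 1/qfac (+ k))
        ≡⟨ cong₂ (λ x m → q^ τ * qpoch x m * (1/qfac (+ i) * 1ℚ * 1/qfac (+ k)))
                 (base L (+ i) (+ k)) (cong (ℕ._+ k) (ℕ.+-identityʳ i)) ⟩
      q^ τ * qpoch (+ 1 ℤ.+ (L ℤ.- + i ℤ.- + k)) (i ℕ.+ k) * (1/qfac (+ i) * 1ℚ * 1/qfac (+ k))
        ≡⟨ regroup₁ (q^ τ) (qpoch (+ 1 ℤ.+ (L ℤ.- + i ℤ.- + k)) (i ℕ.+ k)) (1/qfac (+ i)) (1/qfac (+ k)) ⟩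
      q^ τ * (qpoch (+ 1 ℤ.+ (L ℤ.- + i ℤ.- + k)) (i ℕ.+ k) * (1/qfac (+ i) * 1/qfac (+ k)))
        ≡⟨ cong (q^ τ *_) (sym (qbinom-trinomial L i k)) ⟩
      q^ τ * (qbinom q (L ℤ.- + k) (+ i) * qbinom q L (+ k))
        ≡⟨ regroup₂ (q^ τ) (qbinom q (L ℤ.- + k) (+ i)) (qbinom q L (+ k)) ⟩
      q^ τ * qbinom q (L ℤ.- + k) (+ i) * 1ℚ * qbinom q L (+ k)
        ≡⟨ cong (λ t → q^ τ * qbinom q (L ℤ.- + k) (+ i) * 1ℚ * qbinom q t (+ k)) (sym (ℤ.+-identityʳ L)) ⟩
      binomProduct (+ i) (+ 0) (+ k) L ∎
      where
      τ = T (+ i) ℤ.+ T (+ 0) ℤ.+ T (+ k)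
      base : ∀ L I K → + 1 ℤ.+ (L ℤ.- I ℤ.- + 0 ℤ.- K) ≡ + 1 ℤ.+ (L ℤ.- I ℤ.- K)
      base = ℤ-solve-∀
      regroup₁ : ∀ t p x y → t * p * (x * 1ℚ * y) ≡ t * (p * (x * y))
      regroup₁ = solve-∀ ℚ-ring
      regroup₂ : ∀ t x y → t * (x * y) ≡ t * x * 1ℚ * y
      regroup₂ = solve-∀ ℚ-ring

    sumF≡binomProduct : ∀ i j k L → sumF i j k L ≡ binomProduct (+ i) (+ j) (+ k) L
    sumF≡binomProduct zero    j       k L = sumF-at-i≡0 j k L
    sumF≡binomProduct (suc i) zero    k L = sumF-at-j≡0 (suc i) k L
    sumF≡binomProduct (suc i) (suc j) k L =
      subst (λ M → sumF (suc i) (suc j) k M ≡ binomProduct (+ suc i) (+ suc j) (+ k) M) (1+[L-1]≡L L)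
        (*-cancelˡ-≢0 (c₁-≢0 i j) (begin
          c₁ i j * sumF (suc i) (suc j) k (+ 1 ℤ.+ L′)
            ≡⟨ sumF-recurrence i j k L′ ⟩
          c₂ i j k L′ * sumF i j k L′
            ≡⟨ cong (c₂ i j k L′ *_) (sumF≡binomProduct i j k L′) ⟩
          c₂ i j k L′ * binomProduct (+ i) (+ j) (+ k) L′
            ≡⟨ sym (binomProduct-recurrence i j k L′) ⟩
          c₁ i j * binomProduct (+ suc i) (+ suc j) (+ k) (+ 1 ℤ.+ L′) ∎))
      where
      L′ = L ℤ.- + 1
      1+[L-1]≡L : ∀ L → + 1 ℤ.+ (L ℤ.- + 1) ≡ L
      1+[L-1]≡L = ℤ-solve-∀

    summand≡F-in-range : ∀ L {s i j k} →
                         Σ ℕ (λ a → s ℕ.+ a ≡ i) → Σ ℕ (λ b → s ℕ.+ b ≡ j) → Σ ℕ (λ c → s ℕ.+ c ≡ k) →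
                         summand (+ i) (+ j) (+ k) L s ≡ F i j k L s
    summand≡F-in-range L {s} (a , refl) (b , refl) (c , refl) = begin
      q^ ε * qmultinom q (L ℤ.- S) (S ∷ (+ (s ℕ.+ a) ℤ.- S) ∷ (+ (s ℕ.+ b) ℤ.- S) ∷ [])
           * qbinom q t (+ (s ℕ.+ c) ℤ.- S)
        ≡⟨ cong₂ (λ m z → q^ ε * m * qbinom q t z)
                 (cong₂ (λ x y → qmultinom q (L ℤ.- S) (S ∷ x ∷ y ∷ [])) (cancel S (+ a)) (cancel S (+ b)))
                 (cancel S (+ c)) ⟩
      q^ ε * qmultinom q (L ℤ.- S) (S ∷ + a ∷ + b ∷ []) * qbinom q t (+ c)
        ≡⟨ cong (λ m → q^ ε * m * qbinom q t (+ c)) (qmultinom-ℕ (L ℤ.- S) s a b) ⟩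
      q^ ε * (qpoch x m * (rₛ * rₐ * r_b)) * (qpoch y c * r_c)
        ≡⟨ regroup (q^ ε) (qpoch x m) (qpoch y c) rₛ rₐ r_b r_c ⟩
      q^ ε * (qpoch y c * qpoch x m) * (rₛ * rₐ * r_b * r_c)
        ≡⟨ cong₂ (λ u v → q^ ε * (qpoch u c * qpoch v m) * (rₛ * rₐ * r_b * r_c))
                 (base₁ L S (+ a) (+ b) (+ c)) (base₂ L S (+ a) (+ b) (+ c)) ⟩
      q^ ε * (qpoch β c * qpoch (β ℤ.+ + c) m) * (rₛ * rₐ * r_b * r_c)
        ≡⟨ cong (λ p → q^ ε * p * (rₛ * rₐ * r_b * r_c)) (sym (qpoch-+ β c m)) ⟩
      q^ ε * qpoch β (c ℕ.+ m) * (rₛ * rₐ * r_b * r_c)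
        ≡⟨ cong₂ (λ n r → q^ ε * qpoch β n * r) (sym length≡)
                 (cong₂ _*_ (cong₂ (λ x y → rₛ * x * y) (cong 1/qfac (sym (cancel S (+ a)))) (cong 1/qfac (sym (cancel S (+ b)))))
                            (cong 1/qfac (sym (cancel S (+ c))))) ⟩
      F (s ℕ.+ a) (s ℕ.+ b) (s ℕ.+ c) L s ∎
      where
      S = + s
      ε = E (+ (s ℕ.+ a)) (+ (s ℕ.+ b)) (+ (s ℕ.+ c)) L S
      t = L ℤ.- + (s ℕ.+ a) ℤ.- + (s ℕ.+ b)
      m = s ℕ.+ a ℕ.+ b
      x = + 1 ℤ.+ (L ℤ.- S) ℤ.- (S ℤ.+ + a ℤ.+ + b)
      y = (t ℤ.- + c) ℤ.+ + 1
      β = + 1 ℤ.+ (N (+ (s ℕ.+ a)) (+ (s ℕ.+ b)) (+ (s ℕ.+ c)) L ℤ.+ S)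
      rₛ = 1/qfac S
      rₐ = 1/qfac (+ a)
      r_b = 1/qfac (+ b)
      r_c = 1/qfac (+ c)
      cancel : ∀ S A → (S ℤ.+ A) ℤ.- S ≡ A
      cancel = ℤ-solve-∀
      base₁ : ∀ L S A B C → (L ℤ.- (S ℤ.+ A) ℤ.- (S ℤ.+ B) ℤ.- C) ℤ.+ + 1
                            ≡ + 1 ℤ.+ (L ℤ.- (S ℤ.+ A) ℤ.- (S ℤ.+ B) ℤ.- (S ℤ.+ C) ℤ.+ S)
      base₁ = ℤ-solve-∀
      base₂ : ∀ L S A B C → + 1 ℤ.+ (L ℤ.- S) ℤ.- (S ℤ.+ A ℤ.+ B)
                            ≡ + 1 ℤ.+ (L ℤ.- (S ℤ.+ A) ℤ.- (S ℤ.+ B) ℤ.- (S ℤ.+ C) ℤ.+ S) ℤ.+ C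
      base₂ = ℤ-solve-∀
      regroup : ∀ e p p′ r₁ r₂ r₃ r₄ →
        e * (p * (r₁ * r₂ * r₃)) * (p′ * r₄) ≡ e * (p′ * p) * (r₁ * r₂ * r₃ * r₄)
      regroup = solve-∀ ℚ-ring
      expand : ∀ s a b c → s ℕ.+ a ℕ.+ (s ℕ.+ b) ℕ.+ (s ℕ.+ c) ≡ s ℕ.+ s ℕ.+ (c ℕ.+ (s ℕ.+ a ℕ.+ b))
      expand = ℕ-solve-∀
      length≡ : (s ℕ.+ a ℕ.+ (s ℕ.+ b) ℕ.+ (s ℕ.+ c)) ℕ.∸ (s ℕ.+ s) ≡ c ℕ.+ m
      length≡ = trans (cong (ℕ._∸ (s ℕ.+ s)) (expand s a b c)) (ℕ.m+n∸m≡n (s ℕ.+ s) (c ℕ.+ m))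

    summand-vanishes : ∀ i j k L s → OutOfRange i j k s → summand i j k L s ≡ 0ℚ
    summand-vanishes i j k L s = vanish
      where
      e = q^ E i j k L (+ s)
      m = qmultinom q (L ℤ.- + s) (+ s ∷ (i ℤ.- + s) ∷ (j ℤ.- + s) ∷ [])
      b = qbinom q (L ℤ.- i ℤ.- j) (k ℤ.- + s)
      middle-zero : ∀ x y → x * 0ℚ * y ≡ 0ℚ
      middle-zero = solve-∀ ℚ-ring
      multinomial-vanishes : ℤ.Negative (i ℤ.- + s) ⊎ ℤ.Negative (j ℤ.- + s) → e * m * b ≡ 0ℚ
      multinomial-vanishes neg =
        trans (cong (λ x → e * x * b) (qmultinom-vanishes q (L ℤ.- + s) s (i ℤ.- + s) (j ℤ.- + s) neg)) (middle-zero e b)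
      vanish : OutOfRange i j k s → e * m * b ≡ 0ℚ
      vanish (inj₁ neg)        = multinomial-vanishes (inj₁ neg)
      vanish (inj₂ (inj₁ neg)) = multinomial-vanishes (inj₂ neg)
      vanish (inj₂ (inj₂ neg)) = trans (cong (e * m *_) (qbinom-vanishes q _ (k ℤ.- + s) neg)) (ℚ.*-zeroʳ (e * m))

    summand≡F-out-of-range : ∀ i j k L s → OutOfRange (+ i) (+ j) (+ k) s → summand (+ i) (+ j) (+ k) L s ≡ F i j k L s
    summand≡F-out-of-range i j k L s out =
      trans (summand-vanishes (+ i) (+ j) (+ k) L s out) (sym (F-vanishes i j k L s out))

    summand≡F : ∀ i j k L s → summand (+ i) (+ j) (+ k) L s ≡ F i j k L s
    summand≡F i j k L s with s ℕ.≤? i | s ℕ.≤? j | s ℕ.≤? k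
    ... | yes s≤i | yes s≤j | yes s≤k =
      summand≡F-in-range L (ℕ.m≤n⇒∃[o]m+o≡n s≤i) (ℕ.m≤n⇒∃[o]m+o≡n s≤j) (ℕ.m≤n⇒∃[o]m+o≡n s≤k)
    ... | no s≰i | _      | _      = summand≡F-out-of-range i j k L s (inj₁ ([+m]-[+n]-negative (ℕ.≰⇒> s≰i)))
    ... | yes _  | no s≰j | _      = summand≡F-out-of-range i j k L s (inj₂ (inj₁ ([+m]-[+n]-negative (ℕ.≰⇒> s≰j))))
    ... | yes _  | yes _  | no s≰k = summand≡F-out-of-range i j k L s (inj₂ (inj₂ ([+m]-[+n]-negative (ℕ.≰⇒> s≰k))))

    binomProduct-vanishes : ∀ i j k L → ℤ.Negative i ⊎ ℤ.Negative j ⊎ ℤ.Negative k → binomProduct i j k L ≡ 0ℚ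
    binomProduct-vanishes i j k L neg = product₄-zero {q^ (T i ℤ.+ T j ℤ.+ T k)} (inj₂ (vanishing-factor neg))
      where
      vanishing-factor : ℤ.Negative i ⊎ ℤ.Negative j ⊎ ℤ.Negative k →
        qbinom q (L ℤ.- k) i ≡ 0ℚ ⊎ qbinom q (L ℤ.- i) j ≡ 0ℚ ⊎ qbinom q (L ℤ.- j) k ≡ 0ℚ
      vanishing-factor (inj₁ neg)        = inj₁ (qbinom-vanishes q _ i neg)
      vanishing-factor (inj₂ (inj₁ neg)) = inj₂ (inj₁ (qbinom-vanishes q _ j neg))
      vanishing-factor (inj₂ (inj₂ neg)) = inj₂ (inj₂ (qbinom-vanishes q _ k neg))

    Σsummand≡binomProduct : ∀ i j k L → Σ≤ ∣ i ∣ (summand i j k L) ≡ binomProduct i j k L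
    Σsummand≡binomProduct (+ i) (+ j) (+ k) L = trans (Σ≤-cong i (summand≡F i j k L)) (sumF≡binomProduct i j k L)
    Σsummand≡binomProduct -[1+ n ] j k L =
      trans (Σ≤-zero (suc n) (summand -[1+ n ] j k L)
                     (λ s → summand-vanishes -[1+ n ] j k L s (inj₁ (-[1+n]-[+s]-negative n s))))
            (sym (binomProduct-vanishes -[1+ n ] j k L (inj₁ _)))
    Σsummand≡binomProduct (+ i) -[1+ n ] k L =
      trans (Σ≤-zero i (summand (+ i) -[1+ n ] k L)
                     (λ s → summand-vanishes (+ i) -[1+ n ] k L s (inj₂ (inj₁ (-[1+n]-[+s]-negative n s)))))
            (sym (binomProduct-vanishes (+ i) -[1+ n ] k L (inj₂ (inj₁ _))))
    Σsummand≡binomProduct (+ i) (+ j) -[1+ n ] L =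
      trans (Σ≤-zero i (summand (+ i) (+ j) -[1+ n ] L)
                     (λ s → summand-vanishes (+ i) (+ j) -[1+ n ] L s (inj₂ (inj₂ (-[1+n]-[+s]-negative n s)))))
            (sym (binomProduct-vanishes (+ i) (+ j) -[1+ n ] L (inj₂ (inj₂ _))))

mainTheorem2 : (q : ℚ) → q ≢ 0ℚ → ((n : ℕ) → q ^ⁿ suc n ≢ 1ℚ) →
    (i j k L : ℤ) →
    Σ≤ ∣ i ∣ (λ s′ → let s = + s′ in
        (q ^ᶻ (s ℤ.* (L ℤ.+ + 2) ℤ.- T s ℤ.+ T (i ℤ.- s) ℤ.+ T (j ℤ.- s) ℤ.+ T (k ℤ.- s)))
        ℚ.* qmultinom q (L ℤ.- s) (s ∷ (i ℤ.- s) ∷ (j ℤ.- s) ∷ [])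
        ℚ.* qbinom q (L ℤ.- i ℤ.- j) (k ℤ.- s))
    ≡ (q ^ᶻ (T i ℤ.+ T j ℤ.+ T k))
        ℚ.* qbinom q (L ℤ.- k) i
        ℚ.* qbinom q (L ℤ.- i) j
        ℚ.* qbinom q (L ℤ.- j) k
mainTheorem2 = Σsummand≡binomProduct
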